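{- For every quasi-discrete closure model $\mathcal{M}=(X,\vec{\mathcal{C}},\mathcal{V})$ and all $x_1,x_2\in X$: $x_1$ and $x_2$ satisfy exactly the same IMLC formulas if and only if $x_1$ and $x_2$ are CMC-bisimilar.
   Context: For $R\subseteq X\times X$ on a non-empty set $X$, let $\mathcal{C}_R(A)=A\cup\{x:\exists a\in A,(a,x)\in R\}$. A QdCM is $(X,\vec{\mathcal{C}},\mathcal{V})$ with $\vec{\mathcal{C}}=\mathcal{C}_R$ for some $R$, and $\mathcal{V}:AP\to\mathcal{P}(X)$ for a fixed set $AP$; $\mathcal{V}^{ -1}(x)=\{p:x\in\mathcal{V}(p)\}$. Let $\overleftarrow{\mathcal{C}}=\mathcal{C}_{R^{ -1}}$, $\vec{\mathcal{I}}(A)=X\setminus\vec{\mathcal{C}}(X\setminus A)$, $\overleftarrow{\mathcal{I}}(A)=X\setminus\overleftarrow{\mathcal{C}}(X\setminus A)$. IMLC formulas: $\Phi::=p\mid\neg\Phi\mid\bigwedge_{i\in I}\Phi_i\mid\vec{\mathcal{N}}\Phi\mid\overleftarrow{\mathcal{N}}\Phi$ ($p\in AP$, $I$ arbitrary index set). Semantics: $x\models p$ iff $x\in\mathcal{V}(p)$; $\neg,\bigwedge$ as usual; $x\models\vec{\mathcal{N}}\Phi$ iff $x\in\vec{\mathcal{C}}([\![\Phi]\!])$; $x\models\overleftarrow{\mathcal{N}}\Phi$ iff $x\in\overleftarrow{\mathcal{C}}([\![\Phi]\!])$, where $[\![\Phi]\!]=\{y:y\models\Phi\}$. CMC-bisimulation: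 non-empty $B\subseteq X\times X$ such that whenever $(x_1,x_2)\in B$: (1) $\mathcal{V}^{ -1}(x_1)=\mathcal{V}^{ -1}(x_2)$; (2) for every $S_1$ with $x_1\in\vec{\mathcal{I}}(S_1)$ there is $S_2$ with $x_2\in\vec{\mathcal{I}}(S_2)$ such that every $s_2\in S_2$ has $s_1\in S_1$ with $(s_1,s_2)\in B$; (3) for every $S_2$ with $x_2\in\vec{\mathcal{I}}(S_2)$ there is $S_1$ with $x_1\in\vec{\mathcal{I}}(S_1)$ such that every $s_1\in S_1$ has $s_2\in S_2$ with $(s_1,s_2)\in B$; (4),(5): as (2),(3) with $\overleftarrow{\mathcal{I}}$ in place of $\vec{\mathcal{I}}$. CMC-bisimilar: contained in some CMC-bisimulation. -}

module Defs where

open import Level using (0ℓ) renaming (suc to lsuc)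
open import Data.Product using (Σ; ∃; _×_; _,_)
open import Data.Sum using (_⊎_)
open import Relation.Nullary using (¬_)
open import Function.Bundles using (_⇔_)

-- A quasi-discrete closure model over the fixed set AP of atomic propositions.
-- Subsets of X are predicates X → Set; the closure operator is C_R for the
-- relation R stored in the model.
record QdCM (AP : Set) : Set₁ where
  field
    X        : Set
    inhabited : X
    R        : X → X → Set
    V        : AP → X → Set

module _ {AP : Set} (M : QdCM AP) where
  open QdCM M

  Subset : Set₁
  Subset = X → Set

  ∁ : Subset → Subset
  ∁ A x = ¬ A x

  closureOf : (X → X → Set) → Subset → Subset
  closureOf S A x = A x ⊎ (Σ X λ a → A a × S a x)

  R⁻¹ : X → X → Set
  R⁻¹ x y = R y x

  C→ : Subset → Subset
  C→ = closureOf R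

  C← : Subset → Subset
  C← = closureOf R⁻¹

  I→ : Subset → Subset
  I→ A = ∁ (C→ (∁ A))

  I← : Subset → Subset
  I← A = ∁ (C← (∁ A))

  -- V⁻¹(x) = V⁻¹(y), as equality of subsets of AP
  sameAtoms : X → X → Set
  sameAtoms x y = (p : AP) → V p x ⇔ V p y

data Formula (AP : Set) : Set₁ where
  atom : AP → Formula AP
  ¬'_  : Formula AP → Formula AP
  ⋀    : (I : Set) → (I → Formula AP) → Formula AP
  N→   : Formula AP → Formula AP
  N←   : Formula AP → Formula AP

module _ {AP : Set} (M : QdCM AP) where
  open QdCM M

  _⊨_ : X → Formula AP → Set
  x ⊨ atom p  = V p x
  x ⊨ (¬' Φ)  = ¬ (x ⊨ Φ)
  x ⊨ ⋀ I Φs  = (i : I) → x ⊨ Φs i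
  x ⊨ N→ Φ    = C→ M (λ y → y ⊨ Φ) x
  x ⊨ N← Φ    = C← M (λ y → y ⊨ Φ) x

  IMLC-equivalent : X → X → Set₁
  IMLC-equivalent x₁ x₂ = (Φ : Formula AP) → (x₁ ⊨ Φ) ⇔ (x₂ ⊨ Φ)

  record IsCMCBisimulation (B : X → X → Set) : Set₁ where
    field
      nonEmpty : Σ X λ x₁ → Σ X λ x₂ → B x₁ x₂
      atoms    : ∀ {x₁ x₂} → B x₁ x₂ → sameAtoms M x₁ x₂
      fwd₁     : ∀ {x₁ x₂} → B x₁ x₂ → (S₁ : Subset M) → I→ M S₁ x₁ →
                 Σ (Subset M) λ S₂ → I→ M S₂ x₂ ×
                   ((s₂ : X) → S₂ s₂ → Σ X λ s₁ → S₁ s₁ × B s₁ s₂)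
      fwd₂     : ∀ {x₁ x₂} → B x₁ x₂ → (S₂ : Subset M) → I→ M S₂ x₂ →
                 Σ (Subset M) λ S₁ → I→ M S₁ x₁ ×
                   ((s₁ : X) → S₁ s₁ → Σ X λ s₂ → S₂ s₂ × B s₁ s₂)
      bwd₁     : ∀ {x₁ x₂} → B x₁ x₂ → (S₁ : Subset M) → I← M S₁ x₁ →
                 Σ (Subset M) λ S₂ → I← M S₂ x₂ ×
                   ((s₂ : X) → S₂ s₂ → Σ X λ s₁ → S₁ s₁ × B s₁ s₂)
      bwd₂     : ∀ {x₁ x₂} → B x₁ x₂ → (S₂ : Subset M) → I← M S₂ x₂ →
                 Σ (Subset M) λ S₁ → I← M S₁ x₁ ×
                   ((s₁ : X) → S₁ s₁ → Σ X λ s₂ → S₂ s₂ × B s₁ s₂)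

  CMC-bisimilar : X → X → Set₁
  CMC-bisimilar x₁ x₂ = Σ (X → X → Set) λ B → IsCMCBisimulation B × B x₁ x₂

-- Soundness: a bisimulation step transports the interior witnessing that a point
-- is outside C(¬⟦Φ⟧) to the related point, so by induction on Φ related points
-- agree on every formula.  Completeness: IMLC-equivalence is itself a
-- bisimulation.  Given x₁ ∈ I(S₁), take S₂ to be the points equivalent to some
-- point of S₁.  A point y outside S₂ is separated from each s ∈ S₁ by a formula;
-- the infinitary conjunction of these holds at y and nowhere on S₁, so if y
-- witnessed x₂ ∈ C(¬S₂), the corresponding N-formula would hold at x₂, hence at
-- x₁, placing x₁ in C(¬S₁).  Both directions use excluded middle.
module Submission where

open import Defs
open import Level using (0ℓ; lift; lower) renaming (suc to lsuc)
open import Axiom.ExcludedMiddle using (ExcludedMiddle)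
open import Axiom.DoubleNegationElimination using (DoubleNegationElimination; em⇒dne)
open import Function.Base using (flip)
open import Function.Bundles using (_⇔_; mk⇔; Equivalence)
open import Function.Properties.Equivalence using (sym)
open import Data.Product using (Σ; _×_; _,_; proj₁; proj₂)
open import Data.Sum using (inj₁; inj₂)
open import Data.Empty using (⊥)
open import Relation.Nullary using (¬_)
open import Relation.Nullary.Decidable using (True; toWitness; fromWitness)
open import Relation.Binary.Core using (Rel)

module _ {AP : Set} (M : QdCM AP) where
  open QdCM M

  closure-mono : (S : Rel X 0ℓ) {A A′ : Subset M} → (∀ y → A y → A′ y) →
                 ∀ {x} → closureOf M S A x → closureOf M S A′ x
  closure-mono S A⊆A′ (inj₁ a)           = inj₁ (A⊆A′ _ a)
  closure-mono S A⊆A′ (inj₂ (y , a , r)) = inj₂ (y , A⊆A′ y a , r)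

  interiorOf : Rel X 0ℓ → Subset M → Subset M
  interiorOf S A = ∁ M (closureOf M S (∁ M A))

  -- One of the transfer clauses (2)–(5) of a CMC-bisimulation, for the
  -- closure of S: clause (2) is  Zig R B x₁ x₂,  clause (3) is  Zig R (flip B) x₂ x₁.
  Zig : Rel X 0ℓ → Rel X 0ℓ → X → X → Set₁
  Zig S B x₁ x₂ = (S₁ : Subset M) → interiorOf S S₁ x₁ →
    Σ (Subset M) λ S₂ → interiorOf S S₂ x₂ ×
      ((s₂ : X) → S₂ s₂ → Σ X λ s₁ → S₁ s₁ × B s₁ s₂)

  ⟦_⟧ : Formula AP → Subset M
  ⟦ Φ ⟧ x = _⊨_ M x Φ

module Classical (lem : ExcludedMiddle (lsuc 0ℓ)) {AP : Set} (M : QdCM AP) where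
  open QdCM M

  dne₀ : DoubleNegationElimination 0ℓ
  dne₀ ¬¬p = lower (em⇒dne lem λ ¬p↑ → ¬¬p λ p → ¬p↑ (lift p))

  closure-preserved : (S B : Rel X 0ℓ) {A : Subset M} →
    (∀ {s₁ s₂} → B s₁ s₂ → A s₁ → A s₂) →
    ∀ {x₁ x₂} → Zig M S (flip B) x₂ x₁ → closureOf M S A x₁ → closureOf M S A x₂
  closure-preserved S B {A} preserves zig x₁∈CA = dne₀ λ x₂∉CA →
    let (S₁ , x₁∈IS₁ , S₁⇒∁A) = zig (∁ M A) λ c → x₂∉CA (closure-mono M S (λ _ → dne₀) c)
        A⊆∁S₁ : ∀ y → A y → ¬ S₁ y
        A⊆∁S₁ y a s = let (_ , ¬a , b) = S₁⇒∁A y s in ¬a (preserves b a)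
    in x₁∈IS₁ (closure-mono M S A⊆∁S₁ x₁∈CA)

  bisimulation-preserves : {B : Rel X 0ℓ} → IsCMCBisimulation M B →
    ∀ Φ {x₁ x₂} → B x₁ x₂ → ⟦ M ⟧ Φ x₁ ⇔ ⟦ M ⟧ Φ x₂
  bisimulation-preserves {B} bis = preserves
    where
    open IsCMCBisimulation bis
    open Equivalence
    preserves : ∀ Φ {x₁ x₂} → B x₁ x₂ → ⟦ M ⟧ Φ x₁ ⇔ ⟦ M ⟧ Φ x₂
    preserves (atom p)  b = atoms b p
    preserves (¬' Φ)    b = mk⇔ (λ ¬φ φ → ¬φ (from (preserves Φ b) φ))
                                (λ ¬φ φ → ¬φ (to (preserves Φ b) φ))
    preserves (⋀ I Φs)  b = mk⇔ (λ φs i → to (preserves (Φs i) b) (φs i))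
                                (λ φs i → from (preserves (Φs i) b) (φs i))
    preserves (N→ Φ)    b = mk⇔
      (closure-preserved R B (λ b′ → to (preserves Φ b′)) (fwd₂ b))
      (closure-preserved R (flip B) (λ b′ → from (preserves Φ b′)) (fwd₁ b))
    preserves (N← Φ)    b = mk⇔
      (closure-preserved (R⁻¹ M) B (λ b′ → to (preserves Φ b′)) (bwd₂ b))
      (closure-preserved (R⁻¹ M) (flip B) (λ b′ → from (preserves Φ b′)) (bwd₁ b))

  separating : ∀ {s y} → ¬ IMLC-equivalent M s y →
               Σ (Formula AP) λ Φ → ⟦ M ⟧ Φ y × ¬ ⟦ M ⟧ Φ s
  separating {s} {y} s≉y = em⇒dne lem λ inseparable → s≉y λ Φ → mk⇔
    (λ φs → dne₀ λ ¬φy → inseparable (¬' Φ , ¬φy , λ ¬φs → ¬φs φs))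
    (λ φy → dne₀ λ ¬φs → inseparable (Φ , φy , ¬φs))

  avoiding : (A : Subset M) {y : X} → (∀ s → A s → ¬ IMLC-equivalent M s y) →
             Σ (Formula AP) λ Ψ → ⟦ M ⟧ Ψ y × (∀ z → ⟦ M ⟧ Ψ z → ¬ A z)
  avoiding A A≉y =
      ⋀ (Σ X A) (λ (s , a) → proj₁ (separating (A≉y s a)))
    , (λ (s , a) → proj₁ (proj₂ (separating (A≉y s a))))
    , λ z ψz a → proj₂ (proj₂ (separating (A≉y z a))) (ψz (z , a))

  equivalence-zig : (S B : Rel X 0ℓ) → (∀ {s₁ s₂} → IMLC-equivalent M s₁ s₂ → B s₁ s₂) →
    ∀ {x₁ x₂} → (∀ Φ → closureOf M S (⟦ M ⟧ Φ) x₂ → closureOf M S (⟦ M ⟧ Φ) x₁) →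
    Zig M S B x₁ x₂
  equivalence-zig S B ≈⇒B {x₁} {x₂} transfer S₁ x₁∈IS₁ = S₂ , x₂∈IS₂ , λ _ s₂ → s₂
    where
    S₂ : Subset M
    S₂ s₂ = Σ X λ s₁ → S₁ s₁ × B s₁ s₂

    -- Both cases of  x₂ ∈ C(¬S₂)  provide a point y ∉ S₂ that puts x₂ into
    -- the closure of every set containing y.
    refute : ∀ y → ¬ S₂ y → (∀ {A} → A y → closureOf M S A x₂) → ⊥
    refute y y∉S₂ via-y =
      let (Ψ , ψy , Ψ⊆∁S₁) = avoiding S₁ λ s s∈S₁ s≈y → y∉S₂ (s , s∈S₁ , ≈⇒B s≈y)
      in x₁∈IS₁ (closure-mono M S Ψ⊆∁S₁ (transfer Ψ (via-y ψy)))

    x₂∈IS₂ : interiorOf M S S₂ x₂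
    x₂∈IS₂ (inj₁ x₂∉S₂)         = refute x₂ x₂∉S₂ inj₁
    x₂∈IS₂ (inj₂ (y , y∉S₂ , r)) = refute y y∉S₂ λ a → inj₂ (y , a , r)

  -- IMLC-equivalence lives in Set₁; deciding it turns it into a Set-valued relation.
  _≈_ : Rel X 0ℓ
  x ≈ y = True (lem {IMLC-equivalent M x y})

  ≈-isBisimulation : ∀ {x₁ x₂} → IMLC-equivalent M x₁ x₂ → IsCMCBisimulation M _≈_
  ≈-isBisimulation {x₁} {x₂} e = record
    { nonEmpty = x₁ , x₂ , fromWitness e
    ; atoms    = λ b p → toWitness b (atom p)
    ; fwd₁     = λ b → equivalence-zig R _≈_ fromWitness λ Φ → from (toWitness b (N→ Φ))
    ; fwd₂     = λ b → equivalence-zig R (flip _≈_) flipped λ Φ → to (toWitness b (N→ Φ))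
    ; bwd₁     = λ b → equivalence-zig (R⁻¹ M) _≈_ fromWitness λ Φ → from (toWitness b (N← Φ))
    ; bwd₂     = λ b → equivalence-zig (R⁻¹ M) (flip _≈_) flipped λ Φ → to (toWitness b (N← Φ))
    }
    where
    open Equivalence
    flipped : ∀ {s₁ s₂} → IMLC-equivalent M s₁ s₂ → s₂ ≈ s₁
    flipped e′ = fromWitness λ Φ → sym (e′ Φ)

corollary2 : ExcludedMiddle (lsuc 0ℓ) →
    (AP : Set) (M : QdCM AP) (x₁ x₂ : QdCM.X M) →
    IMLC-equivalent M x₁ x₂ ⇔ CMC-bisimilar M x₁ x₂
corollary2 lem AP M x₁ x₂ = mk⇔
  (λ e → _≈_ , ≈-isBisimulation e , fromWitness e)
  (λ (B , bis , b) Φ → bisimulation-preserves bis Φ b)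
  where open Classical lem M
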